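{- Let $h\geq 4$ and let $\vec c=[c_1,\ldots,c_h]$ be an $h$-feasible color sequence with $2<c_1\leq c_2\leq\cdots\leq c_h$. Define $a_2,\ldots,a_h$ and $b_2,\ldots,b_h$ by $a_2=c_2-1$, $b_2=c_1-1$, $a_3=\left\lceil \frac{c_3+c_1-c_2}{2}\right\rceil$, $b_3=c_2-c_1+\left\lfloor\frac{c_3+c_1-c_2}{2}\right\rfloor$, and for $i=4,\ldots,h$: if $\sum_{j=2}^{i-1}a_j<\sum_{j=2}^{i-1}b_j$ then $a_i=\lceil c_i/2\rceil$, $b_i=\lfloor c_i/2\rfloor$; otherwise $a_i=\lfloor c_i/2\rfloor$, $b_i=\lceil c_i/2\rceil$. Partition $c_4,\ldots,c_h$ into maximal runs of equal values, $$c_4=\cdots=c_{i_1}<c_{i_1+1}=\cdots=c_{i_2}<\cdots<c_{i_{k-1}+1}=\cdots=c_{i_k}=c_h,$$ and for $1\leq r\leq k$ put $A_r=\sum_{j=4}^{i_r}a_j$, $B_r=\sum_{j=4}^{i_r}b_j$, $C_r=\sum_{j=4}^{i_r}c_j$. Then $\min\{A_r,B_r\}\geq \left\lfloor \frac{C_r}{2}\right\rfloor-1$ for every $1\leq r\leq k$.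
   Context: A color sequence $\vec c$ of dimension $h$ is $h$-feasible if its entries are non-decreasing positive integers with (C1) $\sum_{i=1}^{\ell}c_i\geq\sum_{i=1}^{\ell}2^i$ for every $1\leq\ell\leq h$, and (C2) $\sum_{i=1}^{h}c_i=2^{h+1}-2$. -}

module Defs where

open import Data.Nat using (ℕ; zero; suc; _+_; _∸_; _^_; _≤_; _<_; _/_; _≤ᵇ_; _<ᵇ_)
open import Data.Bool using (if_then_else_)
open import Relation.Binary.PropositionalEquality using (_≡_)
open import Data.Product using (_×_; _,_; proj₁; proj₂)

-- Color sequences are 1-indexed functions c : ℕ → ℕ; only c 1 … c h matter.

-- Σ[ j = m .. n ] f j  (empty sum = 0 when m > n)
Σ[_⋯_] : ℕ → ℕ → (ℕ → ℕ) → ℕ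
Σ[ m ⋯ zero ] f = if m ≤ᵇ 0 then f 0 else 0
Σ[ m ⋯ suc n ] f = Σ[ m ⋯ n ] f + (if m ≤ᵇ suc n then f (suc n) else 0)

⌊_/2⌋ : ℕ → ℕ
⌊ n /2⌋ = n / 2

⌈_/2⌉ : ℕ → ℕ
⌈ n /2⌉ = suc n / 2

record Feasible (h : ℕ) (c : ℕ → ℕ) : Set where
  field
    positive    : ∀ i → 1 ≤ i → i ≤ h → 1 ≤ c i
    nondecr     : ∀ i j → 1 ≤ i → i ≤ j → j ≤ h → c i ≤ c j
    C1          : ∀ ℓ → 1 ≤ ℓ → ℓ ≤ h → Σ[ 1 ⋯ ℓ ] (λ i → 2 ^ i) ≤ Σ[ 1 ⋯ ℓ ] c
    C2          : Σ[ 1 ⋯ h ] c + 2 ≡ 2 ^ (suc h)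

-- state c i = (a_i , b_i , Σ_{j=2}^{i} a_j , Σ_{j=2}^{i} b_j)   for i ≥ 2
State : Set
State = ℕ × ℕ × ℕ × ℕ

state : (ℕ → ℕ) → ℕ → State
state c zero = 0 , 0 , 0 , 0
state c (suc zero) = 0 , 0 , 0 , 0
state c (suc (suc zero)) = (c 2 ∸ 1) , (c 1 ∸ 1) , (c 2 ∸ 1) , (c 1 ∸ 1)
state c (suc (suc (suc zero))) =
  let a₃ = ⌈ (c 3 + c 1) ∸ c 2 /2⌉
      b₃ = (c 2 ∸ c 1) + ⌊ (c 3 + c 1) ∸ c 2 /2⌋
      sa = proj₁ (proj₂ (proj₂ (state c 2)))
      sb = proj₂ (proj₂ (proj₂ (state c 2)))
  in a₃ , b₃ , sa + a₃ , sb + b₃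
state c (suc (suc (suc (suc n)))) =
  let sa = proj₁ (proj₂ (proj₂ (state c (suc (suc (suc n))))))
      sb = proj₂ (proj₂ (proj₂ (state c (suc (suc (suc n))))))
      ci = c (4 + n)
      aᵢ = if sa <ᵇ sb then ⌈ ci /2⌉ else ⌊ ci /2⌋
      bᵢ = if sa <ᵇ sb then ⌊ ci /2⌋ else ⌈ ci /2⌉
  in aᵢ , bᵢ , sa + aᵢ , sb + bᵢ

-- a_i and b_i (meaningful for 2 ≤ i ≤ h)
a : (ℕ → ℕ) → ℕ → ℕ
a c i = proj₁ (state c i)

b : (ℕ → ℕ) → ℕ → ℕ
b c i = proj₁ (proj₂ (state c i))

-- From i = 3 on, the running totals Σ_{j=2}^{i} a_j and Σ_{j=2}^{i} b_j never differ by
-- more than 1, because each step adds the larger half of c_i to the smaller total.  At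
-- i = 3 they differ by 0 or 1 (this uses c₁ ≤ c₂), so the partial sums A, B over 4 … i
-- satisfy −2 ≤ A − B ≤ 1 and A + B = C, whence min{A, B} ≥ ⌊C/2⌋ − 1.
module Submission where

open import Defs
open import Data.Nat using (ℕ; zero; suc; _+_; _∸_; _/_; _≤_; _<_; _⊓_; _≤ᵇ_; _<ᵇ_; z≤n; s≤s)
import Data.Nat as ℕ
open import Data.Nat.Properties
open import Data.Nat.DivMod using (m/n≡1+[m∸n]/n)
open import Data.Bool using (Bool; true; false; if_then_else_)
open import Data.Product using (_×_; _,_; proj₁; proj₂; swap; uncurry)
open import Data.Sum using (_⊎_; inj₁; inj₂)
open import Relation.Nullary using (contradiction)
open import Relation.Nullary.Reflects using (ofʸ; ofⁿ)
open import Relation.Binary.PropositionalEquality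
open import Algebra.Properties.CommutativeSemigroup +-commutativeSemigroup using (interchange)

n/2≡⌊n/2⌋ : ∀ n → n / 2 ≡ ℕ.⌊ n /2⌋
n/2≡⌊n/2⌋ 0             = refl
n/2≡⌊n/2⌋ 1             = refl
n/2≡⌊n/2⌋ (suc (suc n)) =
  trans (m/n≡1+[m∸n]/n {suc (suc n)} {2} (s≤s (s≤s z≤n))) (cong suc (n/2≡⌊n/2⌋ n))

n/2≤[1+n]/2 : ∀ n → ⌊ n /2⌋ ≤ ⌈ n /2⌉
n/2≤[1+n]/2 n rewrite n/2≡⌊n/2⌋ n | n/2≡⌊n/2⌋ (suc n) = ⌊n/2⌋≤⌈n/2⌉ n

[1+n]/2≤1+n/2 : ∀ n → ⌈ n /2⌉ ≤ suc ⌊ n /2⌋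
[1+n]/2≤1+n/2 n rewrite n/2≡⌊n/2⌋ n | n/2≡⌊n/2⌋ (suc n) = ⌊n/2⌋-mono (n≤1+n (suc n))

[1+n]/2+n/2≡n : ∀ n → ⌈ n /2⌉ + ⌊ n /2⌋ ≡ n
[1+n]/2+n/2≡n n rewrite n/2≡⌊n/2⌋ n | n/2≡⌊n/2⌋ (suc n) =
  trans (+-comm ℕ.⌈ n /2⌉ ℕ.⌊ n /2⌋) (⌊n/2⌋+⌈n/2⌉≡n n)

halves-sum : ∀ (β : Bool) n →
  (if β then ⌈ n /2⌉ else ⌊ n /2⌋) + (if β then ⌊ n /2⌋ else ⌈ n /2⌉) ≡ n
halves-sum true  n = [1+n]/2+n/2≡n n
halves-sum false n = trans (+-comm ⌊ n /2⌋ ⌈ n /2⌉) ([1+n]/2+n/2≡n n)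

n≤1+k+k⇒n/2≤k : ∀ {n} k → n ≤ suc (k + k) → ⌊ n /2⌋ ≤ k
n≤1+k+k⇒n/2≤k {n} k n≤1+k+k = begin
  n / 2              ≡⟨ n/2≡⌊n/2⌋ n ⟩
  ℕ.⌊ n /2⌋          ≤⟨ ⌊n/2⌋-mono n≤1+k+k ⟩
  ℕ.⌈ k + k /2⌉      ≡⟨ n≡⌈n+n/2⌉ k ⟨
  k                  ∎
  where open ≤-Reasoning

m+n/2∸1≤m⊓n : ∀ {m n} → m ≤ suc n → n ≤ suc (suc m) → ⌊ m + n /2⌋ ∸ 1 ≤ m ⊓ n
m+n/2∸1≤m⊓n {m} {n} m≤1+n n≤2+m = ⊓-glb
  (∸-monoˡ-≤ 1 (n≤1+k+k⇒n/2≤k (suc m) m+n≤2+2m))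
  (≤-trans (m∸n≤m _ 1) (n≤1+k+k⇒n/2≤k n (+-monoˡ-≤ n m≤1+n)))
  where
  m+n≤2+2m : m + n ≤ suc (suc m + suc m)
  m+n≤2+2m = begin
    m + n                ≤⟨ +-monoʳ-≤ m n≤2+m ⟩
    m + suc (suc m)      ≡⟨ +-suc m (suc m) ⟩
    suc m + suc m        ≤⟨ n≤1+n _ ⟩
    suc (suc m + suc m)  ∎
    where open ≤-Reasoning

Σ-step : ∀ {m n} (f : ℕ → ℕ) → m ≤ suc n → Σ[ m ⋯ suc n ] f ≡ Σ[ m ⋯ n ] f + f (suc n)
Σ-step {m} {n} f m≤1+n with m ≤ᵇ suc n | ≤ᵇ-reflects-≤ m (suc n)
... | true  | _       = refl
... | false | ofⁿ m≰ = contradiction m≤1+n m≰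

Σ-empty : ∀ {m} n (f : ℕ → ℕ) → n < m → Σ[ m ⋯ n ] f ≡ 0
Σ-empty {m} zero    f 0<m with m ≤ᵇ 0 | ≤ᵇ-reflects-≤ m 0
... | true  | ofʸ m≤0 = contradiction m≤0 (<⇒≱ 0<m)
... | false | _       = refl
Σ-empty {m} (suc n) f 1+n<m with m ≤ᵇ suc n | ≤ᵇ-reflects-≤ m (suc n)
... | true  | ofʸ m≤1+n = contradiction m≤1+n (<⇒≱ 1+n<m)
... | false | _         = trans (+-identityʳ _) (Σ-empty n f (<-trans (n<1+n n) 1+n<m))

Σ-telescope : ∀ (s f : ℕ → ℕ) m → (∀ n → m ≤ n → s (suc n) ≡ s n + f (suc n)) →
  ∀ n → m ≤ n → s n ≡ s m + Σ[ suc m ⋯ n ] f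
Σ-telescope s f m step n m≤n with m≤n⇒m<n∨m≡n m≤n
... | inj₂ refl = sym (trans (cong (s m +_) (Σ-empty m f (n<1+n m))) (+-identityʳ (s m)))
Σ-telescope s f m step (suc n) _ | inj₁ m<1+n = begin
  s (suc n)                                  ≡⟨ step n m≤n ⟩
  s n + f (suc n)                            ≡⟨ cong (_+ f (suc n)) (Σ-telescope s f m step n m≤n) ⟩
  s m + Σ[ suc m ⋯ n ] f + f (suc n)          ≡⟨ +-assoc (s m) _ (f (suc n)) ⟩
  s m + (Σ[ suc m ⋯ n ] f + f (suc n))        ≡⟨ cong (s m +_) (Σ-step f (s≤s m≤n)) ⟨
  s m + Σ[ suc m ⋯ suc n ] f                  ∎
  where
  open ≡-Reasoning
  m≤n : m ≤ n
  m≤n = m<1+n⇒m≤n m<1+n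

Balanced : ℕ → ℕ → Set
Balanced x y = x ≤ suc y × y ≤ suc x

balanced-≤ : ∀ {x y} → y ≤ x → x ≤ suc y → Balanced x y
balanced-≤ y≤x x≤1+y = x≤1+y , m≤n⇒m≤1+n y≤x

balanced-+ : ∀ {x y F G} → y ≤ x → x ≤ suc y → F ≤ G → G ≤ suc F → Balanced (x + F) (y + G)
balanced-+ {x} {y} {F} {G} y≤x x≤1+y F≤G G≤1+F =
  +-mono-≤ x≤1+y F≤G , subst (y + G ≤_) (+-suc x F) (+-mono-≤ y≤x G≤1+F)

balanced-step : ∀ x y n → Balanced x y →
  Balanced (x + (if x <ᵇ y then ⌈ n /2⌉ else ⌊ n /2⌋)) (y + (if x <ᵇ y then ⌊ n /2⌋ else ⌈ n /2⌉))
balanced-step x y n (x≤1+y , y≤1+x) with x <ᵇ y | <ᵇ-reflects-< x y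
... | true  | ofʸ x<y = swap (balanced-+ (<⇒≤ x<y) y≤1+x (n/2≤[1+n]/2 n) ([1+n]/2≤1+n/2 n))
... | false | ofⁿ x≮y = balanced-+ (≮⇒≥ x≮y) x≤1+y (n/2≤[1+n]/2 n) ([1+n]/2≤1+n/2 n)

balanced-offset : ∀ {p q A B} → q ≤ p → p ≤ suc q → Balanced (p + A) (q + B) →
  A ≤ suc B × B ≤ suc (suc A)
balanced-offset {p} {q} {A} {B} q≤p p≤1+q (p+A≤1+q+B , q+B≤1+p+A) =
  +-cancelˡ-≤ p A (suc B) p+A≤p+1+B , +-cancelˡ-≤ q B (suc (suc A)) q+B≤q+2+A
  where
  open ≤-Reasoning
  p+A≤p+1+B : p + A ≤ p + suc B
  p+A≤p+1+B = begin
    p + A            ≤⟨ p+A≤1+q+B ⟩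
    suc (q + B)      ≤⟨ s≤s (+-monoˡ-≤ B q≤p) ⟩
    suc (p + B)      ≡⟨ +-suc p B ⟨
    p + suc B        ∎
  q+B≤q+2+A : q + B ≤ q + suc (suc A)
  q+B≤q+2+A = begin
    q + B                ≤⟨ q+B≤1+p+A ⟩
    suc (p + A)          ≤⟨ s≤s (+-monoˡ-≤ A p≤1+q) ⟩
    suc (suc (q + A))    ≡⟨ cong suc (+-suc q A) ⟨
    suc (q + suc A)      ≡⟨ +-suc q (suc A) ⟨
    q + suc (suc A)      ∎

m∸1+[n∸m+o]≡n∸1+o : ∀ {m n} o → 1 ≤ m → m ≤ n → (m ∸ 1) + ((n ∸ m) + o) ≡ (n ∸ 1) + o
m∸1+[n∸m+o]≡n∸1+o {suc m} {suc n} o _ (s≤s m≤n) =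
  trans (sym (+-assoc m (n ∸ m) o)) (cong (_+ o) (m+[n∸m]≡n m≤n))

sa sb : (ℕ → ℕ) → ℕ → ℕ
sa c i = proj₁ (proj₂ (proj₂ (state c i)))
sb c i = proj₂ (proj₂ (proj₂ (state c i)))

sa-suc : ∀ c n → 3 ≤ n → sa c (suc n) ≡ sa c n + a c (suc n)
sa-suc c (suc (suc (suc _))) (s≤s (s≤s (s≤s _))) = refl

sb-suc : ∀ c n → 3 ≤ n → sb c (suc n) ≡ sb c n + b c (suc n)
sb-suc c (suc (suc (suc _))) (s≤s (s≤s (s≤s _))) = refl

a+b≡c : ∀ c n → 4 ≤ n → a c n + b c n ≡ c n
a+b≡c c (suc (suc (suc (suc n)))) (s≤s (s≤s (s≤s (s≤s _)))) =
  halves-sum (sa c (3 + n) <ᵇ sb c (3 + n)) (c (4 + n))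

sb₃≤sa₃≤1+sb₃ : ∀ c → 1 ≤ c 1 → c 1 ≤ c 2 → sb c 3 ≤ sa c 3 × sa c 3 ≤ suc (sb c 3)
sb₃≤sa₃≤1+sb₃ c 1≤c₁ c₁≤c₂ rewrite m∸1+[n∸m+o]≡n∸1+o ⌊ (c 3 + c 1) ∸ c 2 /2⌋ 1≤c₁ c₁≤c₂ =
  +-monoʳ-≤ (c 2 ∸ 1) (n/2≤[1+n]/2 x) ,
  subst (sa c 3 ≤_) (+-suc (c 2 ∸ 1) ⌊ x /2⌋) (+-monoʳ-≤ (c 2 ∸ 1) ([1+n]/2≤1+n/2 x))
  where
  x : ℕ
  x = (c 3 + c 1) ∸ c 2

sa-sb-balanced : ∀ c → Balanced (sa c 3) (sb c 3) → ∀ n → 3 ≤ n → Balanced (sa c n) (sb c n)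
sa-sb-balanced c bal₃ 3 (s≤s (s≤s (s≤s _))) = bal₃
sa-sb-balanced c bal₃ (suc n@(suc (suc (suc _)))) (s≤s (s≤s (s≤s _))) =
  balanced-step (sa c n) (sb c n) (c (suc n)) (sa-sb-balanced c bal₃ n (s≤s (s≤s (s≤s z≤n))))

sa≡sa₃+Σa : ∀ c i → 3 ≤ i → sa c i ≡ sa c 3 + Σ[ 4 ⋯ i ] (a c)
sa≡sa₃+Σa c = Σ-telescope (sa c) (a c) 3 (sa-suc c)

sb≡sb₃+Σb : ∀ c i → 3 ≤ i → sb c i ≡ sb c 3 + Σ[ 4 ⋯ i ] (b c)
sb≡sb₃+Σb c = Σ-telescope (sb c) (b c) 3 (sb-suc c)

Σa+Σb≡Σc : ∀ c i → 3 ≤ i → Σ[ 4 ⋯ i ] (a c) + Σ[ 4 ⋯ i ] (b c) ≡ Σ[ 4 ⋯ i ] c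
Σa+Σb≡Σc c i 3≤i = +-cancelˡ-≡ (sa c 3 + sb c 3) _ _ (begin
  (sa c 3 + sb c 3) + (A + B)   ≡⟨ interchange (sa c 3) (sb c 3) A B ⟩
  (sa c 3 + A) + (sb c 3 + B)   ≡⟨ cong₂ _+_ (sa≡sa₃+Σa c i 3≤i) (sb≡sb₃+Σb c i 3≤i) ⟨
  sa c i + sb c i               ≡⟨ Σ-telescope s c 3 s-suc i 3≤i ⟩
  (sa c 3 + sb c 3) + C         ∎)
  where
  open ≡-Reasoning
  A B C : ℕ
  A = Σ[ 4 ⋯ i ] (a c)
  B = Σ[ 4 ⋯ i ] (b c)
  C = Σ[ 4 ⋯ i ] c
  s : ℕ → ℕ
  s j = sa c j + sb c j
  s-suc : ∀ n → 3 ≤ n → s (suc n) ≡ s n + c (suc n)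
  s-suc n 3≤n = begin
    sa c (suc n) + sb c (suc n)                     ≡⟨ cong₂ _+_ (sa-suc c n 3≤n) (sb-suc c n 3≤n) ⟩
    (sa c n + a c (suc n)) + (sb c n + b c (suc n)) ≡⟨ interchange (sa c n) _ (sb c n) _ ⟩
    s n + (a c (suc n) + b c (suc n))               ≡⟨ cong (s n +_) (a+b≡c c (suc n) (s≤s 3≤n)) ⟩
    s n + c (suc n)                                 ∎

Σa-Σb-bounded : ∀ c → 1 ≤ c 1 → c 1 ≤ c 2 → ∀ i → 3 ≤ i →
  Σ[ 4 ⋯ i ] (a c) ≤ suc (Σ[ 4 ⋯ i ] (b c)) × Σ[ 4 ⋯ i ] (b c) ≤ suc (suc (Σ[ 4 ⋯ i ] (a c)))
Σa-Σb-bounded c 1≤c₁ c₁≤c₂ i 3≤i with sb₃≤sa₃≤1+sb₃ c 1≤c₁ c₁≤c₂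
... | sb₃≤sa₃ , sa₃≤1+sb₃ = balanced-offset sb₃≤sa₃ sa₃≤1+sb₃
  (subst₂ Balanced (sa≡sa₃+Σa c i 3≤i) (sb≡sb₃+Σb c i 3≤i)
    (sa-sb-balanced c (balanced-≤ sb₃≤sa₃ sa₃≤1+sb₃) i 3≤i))

lemma7 : (h : ℕ) → 4 ≤ h → (c : ℕ → ℕ) → Feasible h c → 2 < c 1 →
    ∀ i → 4 ≤ i → i ≤ h → (i ≡ h ⊎ c i < c (suc i)) →
      ⌊ Σ[ 4 ⋯ i ] c /2⌋ ∸ 1 ≤ Σ[ 4 ⋯ i ] (a c) ⊓ Σ[ 4 ⋯ i ] (b c)
lemma7 h 4≤h c feasible 2<c₁ i 4≤i _ _ =
  subst (λ C → ⌊ C /2⌋ ∸ 1 ≤ Σ[ 4 ⋯ i ] (a c) ⊓ Σ[ 4 ⋯ i ] (b c)) (Σa+Σb≡Σc c i 3≤i)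
    (uncurry m+n/2∸1≤m⊓n (Σa-Σb-bounded c 1≤c₁ c₁≤c₂ i 3≤i))
  where
  3≤i : 3 ≤ i
  3≤i = ≤-trans (n≤1+n 3) 4≤i
  1≤c₁ : 1 ≤ c 1
  1≤c₁ = ≤-trans (s≤s z≤n) 2<c₁
  c₁≤c₂ : c 1 ≤ c 2
  c₁≤c₂ = Feasible.nondecr feasible 1 2 (s≤s z≤n) (s≤s z≤n) (≤-trans (s≤s (s≤s z≤n)) 4≤h)
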